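{- Let $p$ be an odd prime. Then $$\sum_{k=0}^{p-1}(4k+1)\frac{\binom{2k}k}{(-4)^k}\equiv(3-2^p)p\pmod{p^3},$$ $$\sum_{k=0}^{p-1}(4k+1)\frac{\binom{2k}k^2}{16^k}\equiv\sum_{k=0}^{p-1}(8k^2+4k+1)\frac{\binom{2k}k^2}{(-16)^k}\equiv(5-2^{p+1})p^2\pmod{p^4},$$ $$\sum_{k=0}^{p-1}\big(3(4k+1)+(4k+1)^3\big)\frac{\binom{2k}k^3}{(-64)^k}\equiv\sum_{k=0}^{p-1}\big(1+3(4k+1)^2\big)\frac{\binom{2k}k^3}{64^k}\equiv4(7-6\cdot2^{p-1})p^3\pmod{p^5},$$ $$4\sum_{k=0}^{p-1}\big((4k+1)+(4k+1)^3\big)\frac{\binom{2k}k^4}{256^k}\equiv\sum_{k=0}^{p-1}\big(1+6(4k+1)^2+(4k+1)^4\big)\frac{\binom{2k}k^4}{(-256)^k}\equiv8(9-2^{p+2})p^4\pmod{p^6}.$$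
   Context: Congruences are in the ring of rationals with denominators prime to $p$. -}

module Defs where

open import Data.Nat as ℕ using (ℕ; zero; suc)
open import Data.Nat.Divisibility using (_∣_)
open import Data.Nat.Combinatorics using (_C_)
open import Data.Integer as ℤ using (ℤ; +_; -[1+_])
open import Data.Rational as ℚ using (ℚ; _+_; _*_; _-_; _/_; 0ℚ; 1ℚ)
open import Data.List using (List; map; foldr; upTo)
open import Data.Product using (Σ; _×_)
open import Relation.Nullary using (¬_)
open import Relation.Binary.PropositionalEquality using (_≡_)

ℕ→ℚ : ℕ → ℚ
ℕ→ℚ n = (+ n) / 1

_^ℚ_ : ℚ → ℕ → ℚ
x ^ℚ zero  = 1ℚ
x ^ℚ suc k = x * (x ^ℚ k)

sumℚ : ℕ → (ℕ → ℚ) → ℚ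
sumℚ n f = foldr _+_ 0ℚ (map f (upTo n))

inv : (m : ℕ) → .{{_ : ℕ.NonZero m}} → ℚ
inv m = (+ 1) / m

ninv : (m : ℕ) → .{{_ : ℕ.NonZero m}} → ℚ
ninv m = -[1+ 0 ] / m

cbin : ℕ → ℚ
cbin k = ℕ→ℚ ((2 ℕ.* k) C k)

-- Congruence a ≡ b (mod p^m) in the ring of rationals whose
-- denominators are prime to p (ℤ_(p)):
-- a - b = p^m * c for some rational c with p ∤ denominator(c).
CongModPow : (p m : ℕ) → ℚ → ℚ → Set
CongModPow p m a b =
  Σ ℚ (λ c → (¬ (p ∣ ℚ.denominatorℕ c)) × (a - b ≡ ℕ→ℚ (p ℕ.^ m) * c))

-- With x = ε·4⁻ᵐ (ε = ±1), the summand κ((2k+1)ᵐ − ε(2k)ᵐ)·C(2k,k)ᵐ·xᵏ equals g(k+1) − g(k) for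
-- g(n) = κε(2n·C(2n,n))ᵐ·xⁿ, because (2k+2)·C(2k+2,k+1) = 4(2k+1)·C(2k,k). Each of the seven sums
-- has this shape for suitable m, κ and ε, so it equals g(p) = κ(2p·C(2p,p))ᵐ·4^(−mp). Modulo
-- p^(m+2) this is κpᵐ(4·4⁻ᵖ)ᵐ, by Babbage's congruence C(2p,p) ≡ 2 (mod p²), which follows from
-- Vandermonde's C(2p,p) = Σᵢ C(p,i)². Finally 4·4⁻ᵖ = T⁻² for T = 2^(p−1), and T ≡ 1 (mod p) by
-- Fermat, so (1 + 2m − 2mT)·T^(2m) ≡ 1 (mod p²) gives (4·4⁻ᵖ)ᵐ ≡ 1 + 2m − 2mT (mod p²).

{-# OPTIONS --safe #-}
module Submission where

open import Defs
open import Data.Nat as ℕ using (ℕ; zero; suc)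
open import Data.Nat.Combinatorics using (_C_)
open import Data.Nat.Primality using (Prime)
open import Data.Product using (∃; _×_; _,_; proj₁; proj₂)
open import Relation.Nullary using (¬_)
open import Relation.Binary.PropositionalEquality hiding ([_])

module Binomials where

  open import Data.Nat using (_+_; _*_; _^_; _∸_; _≤_; _<_; z≤n; s≤s)
  open import Data.Nat.Properties
  open import Data.Nat.Divisibility using (_∣_; divides; ∣⇒≤; ∣-refl; ∣m+n∣m⇒∣n)
  open import Data.Nat.Combinatorics using (nCn≡1; nC1≡n; nCk≡nC[n∸k]; nCk+nC[k+1]≡[n+1]C[k+1]; k>n⇒nCk≡0)
  open import Data.Nat.Primality using (euclidsLemma; prime⇒irreducible; prime[2])
  open import Data.Nat.DivMod using (_%_; _/_; m≡m%n+[m/n]*n; m%n<n)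
  open import Data.Nat.Tactic.RingSolver using (solve-∀)
  open import Data.Sum using (inj₁; inj₂)
  open import Data.Empty using (⊥-elim)

  [k+1]*[n+1]C[k+1]≡[n+1]*nCk : ∀ n k → suc k * (suc n C suc k) ≡ suc n * (n C k)
  [k+1]*[n+1]C[k+1]≡[n+1]*nCk zero    zero    = refl
  [k+1]*[n+1]C[k+1]≡[n+1]*nCk zero    (suc k) = *-zeroʳ (suc (suc k))
  [k+1]*[n+1]C[k+1]≡[n+1]*nCk (suc n) zero    = trans (+-identityʳ _) (trans (nC1≡n (suc (suc n))) (sym (*-identityʳ _)))
  [k+1]*[n+1]C[k+1]≡[n+1]*nCk (suc n) (suc k) = begin
    suc (suc k) * (suc (suc n) C suc (suc k))     ≡⟨ cong (suc (suc k) *_) (nCk+nC[k+1]≡[n+1]C[k+1] (suc n) (suc k)) ⟨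
    suc (suc k) * (A + B)                         ≡⟨ regroup k A B ⟩
    suc k * A + A + suc (suc k) * B               ≡⟨ cong₂ (λ x y → x + A + y) ([k+1]*[n+1]C[k+1]≡[n+1]*nCk n k) ([k+1]*[n+1]C[k+1]≡[n+1]*nCk n (suc k)) ⟩
    suc n * (n C k) + A + suc n * (n C suc k)     ≡⟨ regroup′ n (n C k) A (n C suc k) ⟩
    suc n * (n C k + n C suc k) + A               ≡⟨ cong (λ x → suc n * x + A) (nCk+nC[k+1]≡[n+1]C[k+1] n k) ⟩
    suc n * A + A                                 ≡⟨ +-comm (suc n * A) A ⟩
    suc (suc n) * A                               ∎
    where
    open ≡-Reasoning
    A = suc n C suc k
    B = suc n C suc (suc k)
    regroup : ∀ k a b → suc (suc k) * (a + b) ≡ suc k * a + a + suc (suc k) * b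
    regroup = solve-∀
    regroup′ : ∀ n x a y → suc n * x + a + suc n * y ≡ suc n * (x + y) + a
    regroup′ = solve-∀

  [2k+2]*[2k+2]C[k+1]≡4*[2k+1]*[2k]Ck : ∀ k → 2 * suc k * ((2 * suc k) C suc k) ≡ 4 * suc (2 * k) * ((2 * k) C k)
  [2k+2]*[2k+2]C[k+1]≡4*[2k+1]*[2k]Ck k = begin
    2 * suc k * ((2 * suc k) C suc k)                   ≡⟨ cong (λ n → 2 * suc k * (n C suc k)) (*-suc 2 k) ⟩
    2 * suc k * (suc (suc (2 * k)) C suc k)              ≡⟨ cong (2 * suc k *_) (nCk+nC[k+1]≡[n+1]C[k+1] (suc (2 * k)) k) ⟨
    2 * suc k * (suc (2 * k) C k + X)                    ≡⟨ cong (λ x → 2 * suc k * (x + X)) middle ⟩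
    2 * suc k * (X + X)                                  ≡⟨ regroup (suc k) X ⟩
    4 * (suc k * X)                                      ≡⟨ cong (4 *_) ([k+1]*[n+1]C[k+1]≡[n+1]*nCk (2 * k) k) ⟩
    4 * (suc (2 * k) * ((2 * k) C k))                    ≡⟨ *-assoc 4 (suc (2 * k)) _ ⟨
    4 * suc (2 * k) * ((2 * k) C k)                      ∎
    where
    open ≡-Reasoning
    X = suc (2 * k) C suc k
    middle : suc (2 * k) C k ≡ X
    middle = trans (nCk≡nC[n∸k] k≤2k+1) (cong (suc (2 * k) C_) 2k+1∸k≡k+1)
      where
      k≤2k+1 : k ≤ suc (2 * k)
      k≤2k+1 = m≤n⇒m≤1+n (m≤m+n k (k + 0))
      2k+1∸k≡k+1 : suc (2 * k) ∸ k ≡ suc k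
      2k+1∸k≡k+1 = trans (+-∸-assoc 1 (m≤m+n k (k + 0))) (cong suc (trans (m+n∸m≡n k (k + 0)) (+-identityʳ k)))
    regroup : ∀ m x → 2 * m * (x + x) ≡ 4 * (m * x)
    regroup = solve-∀

  convolution : (ℕ → ℕ) → (ℕ → ℕ) → ℕ → ℕ
  convolution f g zero    = f 0 * g 0
  convolution f g (suc k) = f 0 * g (suc k) + convolution (λ i → f (suc i)) g k

  convolution-congˡ : ∀ {f f′} g k → (∀ i → f i ≡ f′ i) → convolution f g k ≡ convolution f′ g k
  convolution-congˡ g zero    f≗f′ = cong (_* g 0) (f≗f′ 0)
  convolution-congˡ g (suc k) f≗f′ =
    cong₂ _+_ (cong (_* g (suc k)) (f≗f′ 0)) (convolution-congˡ g k (λ i → f≗f′ (suc i)))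

  convolution-distribˡ-+ : ∀ f f′ g k →
    convolution (λ i → f i + f′ i) g k ≡ convolution f g k + convolution f′ g k
  convolution-distribˡ-+ f f′ g zero    = *-distribʳ-+ (g 0) (f 0) (f′ 0)
  convolution-distribˡ-+ f f′ g (suc k) = begin
    (f 0 + f′ 0) * g (suc k) + convolution (λ i → f (suc i) + f′ (suc i)) g k
      ≡⟨ cong₂ _+_ (*-distribʳ-+ (g (suc k)) (f 0) (f′ 0)) (convolution-distribˡ-+ (λ i → f (suc i)) (λ i → f′ (suc i)) g k) ⟩
    f 0 * g (suc k) + f′ 0 * g (suc k) + (convolution (λ i → f (suc i)) g k + convolution (λ i → f′ (suc i)) g k)
      ≡⟨ +-transpose (f 0 * g (suc k)) (f′ 0 * g (suc k)) _ _ ⟩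
    convolution f g (suc k) + convolution f′ g (suc k) ∎
    where
    open ≡-Reasoning
    +-transpose : ∀ a b c d → a + b + (c + d) ≡ a + c + (b + d)
    +-transpose = solve-∀

  convolution-zeroˡ : ∀ g k → convolution (λ _ → 0) g k ≡ 0
  convolution-zeroˡ g zero    = refl
  convolution-zeroˡ g (suc k) = convolution-zeroˡ g k

  convolution-0C : ∀ g k → convolution (0 C_) g k ≡ g k
  convolution-0C g zero    = +-identityʳ (g 0)
  convolution-0C g (suc k) = begin
    g (suc k) + 0 + convolution (λ i → 0 C suc i) g k ≡⟨ cong₂ _+_ (+-identityʳ (g (suc k))) (convolution-zeroˡ g k) ⟩
    g (suc k) + 0                                     ≡⟨ +-identityʳ (g (suc k)) ⟩
    g (suc k)                                         ∎
    where open ≡-Reasoning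

  vandermonde : ∀ m n k → (m + n) C k ≡ convolution (m C_) (n C_) k
  vandermonde zero    n k       = sym (convolution-0C (n C_) k)
  vandermonde (suc m) n zero    = refl
  vandermonde (suc m) n (suc k) = begin
    suc (m + n) C suc k
      ≡⟨ nCk+nC[k+1]≡[n+1]C[k+1] (m + n) k ⟨
    (m + n) C k + (m + n) C suc k
      ≡⟨ cong₂ _+_ (vandermonde m n k) (vandermonde m n (suc k)) ⟩
    convolution (m C_) (n C_) k + (1 * (n C suc k) + convolution (λ i → m C suc i) (n C_) k)
      ≡⟨ +-exchange (convolution (m C_) (n C_) k) (1 * (n C suc k)) _ ⟩
    1 * (n C suc k) + (convolution (m C_) (n C_) k + convolution (λ i → m C suc i) (n C_) k)
      ≡⟨ cong (1 * (n C suc k) +_) (convolution-distribˡ-+ (m C_) (λ i → m C suc i) (n C_) k) ⟨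
    1 * (n C suc k) + convolution (λ i → m C i + m C suc i) (n C_) k
      ≡⟨ cong (1 * (n C suc k) +_) (convolution-congˡ (n C_) k (λ i → nCk+nC[k+1]≡[n+1]C[k+1] m i)) ⟩
    1 * (n C suc k) + convolution (λ i → suc m C suc i) (n C_) k ∎
    where
    open ≡-Reasoning
    +-exchange : ∀ a b c → a + (b + c) ≡ b + (a + c)
    +-exchange = solve-∀

  p∣pCk : ∀ {p k} → Prime p → 0 < k → k < p → p ∣ p C k
  p∣pCk {suc n} {suc k} p-prime _ k<p
    with euclidsLemma (suc k) (suc n C suc k) p-prime
           (divides (n C k) (trans ([k+1]*[n+1]C[k+1]≡[n+1]*nCk n k) (*-comm (suc n) (n C k))))
  ... | inj₁ p∣k+1 = ⊥-elim (<⇒≱ k<p (∣⇒≤ p∣k+1))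
  ... | inj₂ p∣pCk = p∣pCk

  convolution-mod-p² : ∀ p j (h g : ℕ → ℕ) → (∀ i → i < j → p ∣ h i) → (∀ i → 0 < i → i ≤ j → p ∣ g i) →
    ∃ λ u → convolution h g j ≡ h j * g 0 + p * p * u
  convolution-mod-p² p zero    h g _ _ = 0 , sym (trans (cong (h 0 * g 0 +_) (*-zeroʳ (p * p))) (+-identityʳ _))
  convolution-mod-p² p (suc j) h g p∣h p∣g
    with convolution-mod-p² p j (λ i → h (suc i)) g (λ i i<j → p∣h (suc i) (s≤s i<j)) (λ i 0<i i≤j → p∣g i 0<i (m≤n⇒m≤1+n i≤j))
       | p∣h 0 (s≤s z≤n) | p∣g (suc j) (s≤s z≤n) ≤-refl
  ... | u , eq | divides a h0≡ap | divides b gj≡bp = a * b + u , (begin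
    h 0 * g (suc j) + convolution (λ i → h (suc i)) g j ≡⟨ cong₂ _+_ (cong₂ _*_ h0≡ap gj≡bp) eq ⟩
    a * p * (b * p) + (h (suc j) * g 0 + p * p * u)     ≡⟨ regroup a b p (h (suc j) * g 0) u ⟩
    h (suc j) * g 0 + p * p * (a * b + u)               ∎)
    where
    open ≡-Reasoning
    regroup : ∀ a b p x u → a * p * (b * p) + (x + p * p * u) ≡ x + p * p * (a * b + u)
    regroup = solve-∀

  babbage : ∀ {p} → Prime p → ∃ λ u → (2 * p) C p ≡ 2 + p * p * u
  babbage {suc n} p-prime
    with convolution-mod-p² (suc n) n (λ i → suc n C suc i) (suc n C_)
           (λ i i<n → p∣pCk p-prime (s≤s z≤n) (s≤s i<n))
           (λ i 0<i i≤n → p∣pCk p-prime 0<i (s≤s i≤n))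
  ... | u , eq = u , (begin
    (2 * suc n) C suc n                                        ≡⟨ cong (_C suc n) (cong (suc n +_) (+-identityʳ (suc n))) ⟩
    (suc n + suc n) C suc n                                    ≡⟨ vandermonde (suc n) (suc n) (suc n) ⟩
    1 * (suc n C suc n) + convolution (λ i → suc n C suc i) (suc n C_) n ≡⟨ cong₂ _+_ (cong (1 *_) (nCn≡1 (suc n))) eq ⟩
    1 * 1 + ((suc n C suc n) * 1 + suc n * suc n * u)          ≡⟨ cong (λ x → 1 + (x * 1 + suc n * suc n * u)) (nCn≡1 (suc n)) ⟩
    2 + suc n * suc n * u                                      ∎)
    where open ≡-Reasoning

  partialRowSum : ℕ → ℕ → ℕ
  partialRowSum n zero    = 1
  partialRowSum n (suc k) = partialRowSum n k + n C suc k

  partialRowSum-pascal : ∀ n k → partialRowSum (suc n) (suc k) ≡ partialRowSum n (suc k) + partialRowSum n k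
  partialRowSum-pascal n zero    = trans (cong (1 +_) (sym (nCk+nC[k+1]≡[n+1]C[k+1] n 0))) (+-comm 1 (1 + n C 1))
  partialRowSum-pascal n (suc k) = begin
    partialRowSum (suc n) (suc k) + suc n C suc (suc k)
      ≡⟨ cong₂ _+_ (partialRowSum-pascal n k) (sym (nCk+nC[k+1]≡[n+1]C[k+1] n (suc k))) ⟩
    partialRowSum n (suc k) + partialRowSum n k + (n C suc k + n C suc (suc k))
      ≡⟨ regroup (partialRowSum n (suc k)) (partialRowSum n k) (n C suc k) (n C suc (suc k)) ⟩
    partialRowSum n (suc (suc k)) + partialRowSum n (suc k) ∎
    where
    open ≡-Reasoning
    regroup : ∀ a b c d → a + b + (c + d) ≡ a + d + (b + c)
    regroup = solve-∀

  partialRowSum-stable : ∀ n j → partialRowSum n (n + j) ≡ partialRowSum n n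
  partialRowSum-stable n zero    = cong (partialRowSum n) (+-identityʳ n)
  partialRowSum-stable n (suc j) rewrite +-suc n j = begin
    partialRowSum n (n + j) + n C suc (n + j) ≡⟨ cong (partialRowSum n (n + j) +_) (k>n⇒nCk≡0 (s≤s (m≤m+n n j))) ⟩
    partialRowSum n (n + j) + 0               ≡⟨ +-identityʳ _ ⟩
    partialRowSum n (n + j)                   ≡⟨ partialRowSum-stable n j ⟩
    partialRowSum n n                         ∎
    where open ≡-Reasoning

  partialRowSum-total : ∀ n → partialRowSum n n ≡ 2 ^ n
  partialRowSum-total zero    = refl
  partialRowSum-total (suc n) = begin
    partialRowSum (suc n) (suc n)           ≡⟨ partialRowSum-pascal n n ⟩
    partialRowSum n (suc n) + partialRowSum n n ≡⟨ cong (λ k → partialRowSum n k + partialRowSum n n) (+-comm 1 n) ⟩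
    partialRowSum n (n + 1) + partialRowSum n n ≡⟨ cong (_+ partialRowSum n n) (partialRowSum-stable n 1) ⟩
    partialRowSum n n + partialRowSum n n   ≡⟨ cong (λ x → x + x) (partialRowSum-total n) ⟩
    2 ^ n + 2 ^ n                           ≡⟨ cong (2 ^ n +_) (+-identityʳ (2 ^ n)) ⟨
    2 ^ suc n                               ∎
    where open ≡-Reasoning

  partialRowSum-mod-p : ∀ {p} → Prime p → ∀ j → j < p → ∃ λ v → partialRowSum p j ≡ 1 + p * v
  partialRowSum-mod-p {p} p-prime zero _ = 0 , cong suc (sym (*-zeroʳ p))
  partialRowSum-mod-p {p} p-prime (suc j) j<p
    with partialRowSum-mod-p p-prime j (<⇒≤ j<p) | p∣pCk p-prime (s≤s z≤n) j<p
  ... | v , eq | divides a pCj≡ap = v + a , trans (cong₂ _+_ eq pCj≡ap) (regroup p v a)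
    where
    regroup : ∀ p v a → 1 + p * v + a * p ≡ 1 + p * (v + a)
    regroup = solve-∀

  2^p≡2[mod-p] : ∀ {p} → Prime p → ∃ λ v → 2 ^ p ≡ 2 + p * v
  2^p≡2[mod-p] {suc n} p-prime with partialRowSum-mod-p p-prime n ≤-refl
  ... | v , eq = v , (begin
    2 ^ suc n                                ≡⟨ partialRowSum-total (suc n) ⟨
    partialRowSum (suc n) n + suc n C suc n  ≡⟨ cong₂ _+_ eq (nCn≡1 (suc n)) ⟩
    1 + suc n * v + 1                        ≡⟨ +-comm (1 + suc n * v) 1 ⟩
    2 + suc n * v                            ∎)
    where open ≡-Reasoning

  fermat : ∀ {p} → Prime p → p ≢ 2 → ∃ λ q → 2 ^ (p ∸ 1) ≡ 1 + p * q
  fermat {suc n} p-prime p≢2 with 2^p≡2[mod-p] p-prime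
  ... | v , eq with euclidsLemma (suc n) v prime[2] (∣m+n∣m⇒∣n (divides (2 ^ n) (trans (sym eq) (*-comm 2 (2 ^ n)))) (∣-refl {2}))
  ...   | inj₁ 2∣p with prime⇒irreducible p-prime 2∣p
  ...     | inj₁ ()
  ...     | inj₂ p≡2 = ⊥-elim (p≢2 (sym p≡2))
  fermat {suc n} p-prime p≢2 | v , eq | inj₂ (divides q v≡2q) = q , *-cancelˡ-≡ (2 ^ n) (1 + suc n * q) 2 (begin
    2 * 2 ^ n               ≡⟨ eq ⟩
    2 + suc n * v           ≡⟨ cong (λ x → 2 + suc n * x) v≡2q ⟩
    2 + suc n * (q * 2)     ≡⟨ regroup (suc n) q ⟩
    2 * (1 + suc n * q)     ∎)
    where
    open ≡-Reasoning
    regroup : ∀ p q → 2 + p * (q * 2) ≡ 2 * (1 + p * q)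
    regroup = solve-∀

  prime≢2⇒odd : ∀ {p} → Prime p → p ≢ 2 → ∃ λ r → p ≡ suc (2 * r)
  prime≢2⇒odd {p} p-prime p≢2 with p % 2 | m≡m%n+[m/n]*n p 2 | m%n<n p 2
  ... | 0 | p≡[p/2]*2 | _ with prime⇒irreducible p-prime (divides (p / 2) p≡[p/2]*2)
  ...   | inj₁ ()
  ...   | inj₂ 2≡p = ⊥-elim (p≢2 (sym 2≡p))
  prime≢2⇒odd {p} p-prime p≢2 | 1 | p≡1+[p/2]*2 | _ = p / 2 , trans p≡1+[p/2]*2 (cong suc (*-comm (p / 2) 2))
  prime≢2⇒odd {p} p-prime p≢2 | suc (suc _) | _ | s≤s (s≤s ())

  2^[p+j]≡2^[j+1]*2^[p∸1] : ∀ {p} → Prime p → ∀ j → 2 ^ (p + j) ≡ 2 ^ suc j * 2 ^ (p ∸ 1)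
  2^[p+j]≡2^[j+1]*2^[p∸1] {suc n} _ j = trans (cong (2 *_) (^-distribˡ-+-* 2 n j)) (regroup (2 ^ n) (2 ^ j))
    where
    regroup : ∀ x y → 2 * (x * y) ≡ 2 * y * x
    regroup = solve-∀

open Binomials

import Data.Nat.Properties as ℕ
open import Data.Nat.Base using (nonTrivial⇒≢1)
open import Data.Nat.Coprimality using (1-coprimeTo) renaming (sym to coprime-sym)
open import Data.Nat.Divisibility using (_∣_; divides; ∣-trans; ∣1⇒≡1)
open import Data.Nat.Primality using (euclidsLemma; prime⇒irreducible; prime⇒nonTrivial; prime[2])
open import Data.Integer as ℤ using (ℤ; +_)
import Data.Integer.Properties as ℤ
open import Data.Rational as ℚ using (ℚ; _+_; _*_; _-_; -_; 0ℚ; 1ℚ; mkℚ; ↧_; ↧ₙ_)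
open import Data.Rational.Properties
  using ( +-*-commutativeRing; _≟_; normalize-coprime; ↧-*; ↧-+; ↧-neg
        ; *-zeroʳ; *-identityˡ; *-identityʳ; +-identityʳ; +-inverseʳ; neg-distribʳ-*; *-distribˡ-+; *-comm )
open import Data.List using (foldr; upTo)
open import Data.List.Properties using (map-applyUpTo; map-cong)
open import Data.Sum using (inj₁; inj₂; [_,_])
open import Relation.Binary.Bundles using (Setoid)
import Relation.Binary.Reasoning.Setoid as SetoidReasoning
open import Relation.Nullary.Decidable.Core using (dec⇒maybe)
open import Tactic.RingSolver.Core.AlmostCommutativeRing using (AlmostCommutativeRing; fromCommutativeRing)
open import Tactic.RingSolver using (solve-∀)
open import Data.Nat.Solver using (module +-*-Solver)

ℚ-ring : AlmostCommutativeRing _ _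
ℚ-ring = fromCommutativeRing +-*-commutativeRing (λ x → dec⇒maybe (0ℚ ≟ x))

ℕ→ℚ≡mkℚ : ∀ n → ℕ→ℚ n ≡ mkℚ (+ n) 0 (coprime-sym (1-coprimeTo n))
ℕ→ℚ≡mkℚ n = normalize-coprime (coprime-sym (1-coprimeTo n))

ℕ→ℚ-+ : ∀ m n → ℕ→ℚ (m ℕ.+ n) ≡ ℕ→ℚ m + ℕ→ℚ n
ℕ→ℚ-+ m n rewrite ℕ→ℚ≡mkℚ m | ℕ→ℚ≡mkℚ n | ℤ.*-identityʳ (+ m) | ℤ.*-identityʳ (+ n) = refl

ℕ→ℚ-* : ∀ m n → ℕ→ℚ (m ℕ.* n) ≡ ℕ→ℚ m * ℕ→ℚ n
ℕ→ℚ-* m n rewrite ℕ→ℚ≡mkℚ m | ℕ→ℚ≡mkℚ n | sym (ℤ.pos-* m n) = refl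

ℕ→ℚ-^ : ∀ m n → ℕ→ℚ (m ℕ.^ n) ≡ ℕ→ℚ m ^ℚ n
ℕ→ℚ-^ m zero    = refl
ℕ→ℚ-^ m (suc n) = trans (ℕ→ℚ-* m (m ℕ.^ n)) (cong (ℕ→ℚ m *_) (ℕ→ℚ-^ m n))

ℕ→ℚ-κ[a+b] : ∀ κ a b {f} → f ≡ κ ℕ.* (a ℕ.+ b) → ℕ→ℚ f ≡ ℕ→ℚ κ * (ℕ→ℚ a - (- 1ℚ) * ℕ→ℚ b)
ℕ→ℚ-κ[a+b] κ a b {f} f≡κ[a+b] = begin
  ℕ→ℚ f                                 ≡⟨ cong ℕ→ℚ f≡κ[a+b] ⟩
  ℕ→ℚ (κ ℕ.* (a ℕ.+ b))                 ≡⟨ trans (ℕ→ℚ-* κ (a ℕ.+ b)) (cong (ℕ→ℚ κ *_) (ℕ→ℚ-+ a b)) ⟩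
  ℕ→ℚ κ * (ℕ→ℚ a + ℕ→ℚ b)               ≡⟨ minus-minus (ℕ→ℚ κ) (ℕ→ℚ a) (ℕ→ℚ b) ⟩
  ℕ→ℚ κ * (ℕ→ℚ a - (- 1ℚ) * ℕ→ℚ b)      ∎
  where
  open ≡-Reasoning
  minus-minus : ∀ k a b → k * (a + b) ≡ k * (a - (- 1ℚ) * b)
  minus-minus = solve-∀ ℚ-ring

ℕ→ℚ-κ[a-b] : ∀ κ a b {f} → κ ℕ.* b ℕ.+ f ≡ κ ℕ.* a → ℕ→ℚ f ≡ ℕ→ℚ κ * (ℕ→ℚ a - 1ℚ * ℕ→ℚ b)
ℕ→ℚ-κ[a-b] κ a b {f} κb+f≡κa = begin
  ℕ→ℚ f                                   ≡⟨ cancel (ℕ→ℚ κ * ℕ→ℚ b) (ℕ→ℚ f) ⟩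
  ℕ→ℚ κ * ℕ→ℚ b + ℕ→ℚ f - ℕ→ℚ κ * ℕ→ℚ b   ≡⟨ cong (λ x → x + ℕ→ℚ f - ℕ→ℚ κ * ℕ→ℚ b) (ℕ→ℚ-* κ b) ⟨
  ℕ→ℚ (κ ℕ.* b) + ℕ→ℚ f - ℕ→ℚ κ * ℕ→ℚ b   ≡⟨ cong (_- ℕ→ℚ κ * ℕ→ℚ b) (ℕ→ℚ-+ (κ ℕ.* b) f) ⟨
  ℕ→ℚ (κ ℕ.* b ℕ.+ f) - ℕ→ℚ κ * ℕ→ℚ b     ≡⟨ cong (λ x → ℕ→ℚ x - ℕ→ℚ κ * ℕ→ℚ b) κb+f≡κa ⟩
  ℕ→ℚ (κ ℕ.* a) - ℕ→ℚ κ * ℕ→ℚ b           ≡⟨ cong (_- ℕ→ℚ κ * ℕ→ℚ b) (ℕ→ℚ-* κ a) ⟩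
  ℕ→ℚ κ * ℕ→ℚ a - ℕ→ℚ κ * ℕ→ℚ b           ≡⟨ factor (ℕ→ℚ κ) (ℕ→ℚ a) (ℕ→ℚ b) ⟩
  ℕ→ℚ κ * (ℕ→ℚ a - 1ℚ * ℕ→ℚ b)            ∎
  where
  open ≡-Reasoning
  cancel : ∀ x y → y ≡ x + y - x
  cancel = solve-∀ ℚ-ring
  factor : ∀ k a b → k * a - k * b ≡ k * (a - 1ℚ * b)
  factor = solve-∀ ℚ-ring


^ℚ-distribʳ-* : ∀ x y n → (x * y) ^ℚ n ≡ x ^ℚ n * y ^ℚ n
^ℚ-distribʳ-* x y zero    = refl
^ℚ-distribʳ-* x y (suc n) = trans (cong ((x * y) *_) (^ℚ-distribʳ-* x y n)) (interchange x y (x ^ℚ n) (y ^ℚ n))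
  where
  interchange : ∀ x y a b → x * y * (a * b) ≡ x * a * (y * b)
  interchange = solve-∀ ℚ-ring

^ℚ-distribˡ-+-* : ∀ x m n → x ^ℚ (m ℕ.+ n) ≡ x ^ℚ m * x ^ℚ n
^ℚ-distribˡ-+-* x zero    n = sym (*-identityˡ (x ^ℚ n))
^ℚ-distribˡ-+-* x (suc m) n = trans (cong (x *_) (^ℚ-distribˡ-+-* x m n)) (assoc x (x ^ℚ m) (x ^ℚ n))
  where
  assoc : ∀ a b c → a * (b * c) ≡ a * b * c
  assoc = solve-∀ ℚ-ring

1^ℚn≡1 : ∀ n → 1ℚ ^ℚ n ≡ 1ℚ
1^ℚn≡1 zero    = refl
1^ℚn≡1 (suc n) = trans (cong (1ℚ *_) (1^ℚn≡1 n)) refl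

^ℚ-comm : ∀ x m n → (x ^ℚ m) ^ℚ n ≡ (x ^ℚ n) ^ℚ m
^ℚ-comm x zero    n = 1^ℚn≡1 n
^ℚ-comm x (suc m) n = trans (^ℚ-distribʳ-* x (x ^ℚ m) n) (cong ((x ^ℚ n) *_) (^ℚ-comm x m n))

x²^ℚn≡x^ℚ2n : ∀ x n → (x * x) ^ℚ n ≡ x ^ℚ (2 ℕ.* n)
x²^ℚn≡x^ℚ2n x n = begin
  (x * x) ^ℚ n             ≡⟨ ^ℚ-distribʳ-* x x n ⟩
  x ^ℚ n * x ^ℚ n          ≡⟨ ^ℚ-distribˡ-+-* x n n ⟨
  x ^ℚ (n ℕ.+ n)           ≡⟨ cong (λ k → x ^ℚ (n ℕ.+ k)) (ℕ.+-identityʳ n) ⟨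
  x ^ℚ (2 ℕ.* n)           ∎
  where open ≡-Reasoning

involution-^ℚ-odd : ∀ {ε} → ε * ε ≡ 1ℚ → ∀ r → ε ^ℚ suc (2 ℕ.* r) ≡ ε
involution-^ℚ-odd {ε} ε²≡1 r = begin
  ε * ε ^ℚ (2 ℕ.* r)       ≡⟨ cong (ε *_) (x²^ℚn≡x^ℚ2n ε r) ⟨
  ε * (ε * ε) ^ℚ r         ≡⟨ cong (λ x → ε * x ^ℚ r) ε²≡1 ⟩
  ε * 1ℚ ^ℚ r              ≡⟨ cong (ε *_) (1^ℚn≡1 r) ⟩
  ε * 1ℚ                   ≡⟨ *-identityʳ ε ⟩
  ε                        ∎
  where open ≡-Reasoning

sumℚ-suc : ∀ n f → sumℚ (suc n) f ≡ f 0 + sumℚ n (λ k → f (suc k))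
sumℚ-suc n f = cong (λ xs → f 0 + foldr _+_ 0ℚ xs)
  (trans (map-applyUpTo suc f n) (sym (map-applyUpTo (λ k → k) (λ k → f (suc k)) n)))

sumℚ-cong : ∀ n {f g} → (∀ k → f k ≡ g k) → sumℚ n f ≡ sumℚ n g
sumℚ-cong n f≗g = cong (foldr _+_ 0ℚ) (map-cong f≗g (upTo n))

sumℚ-telescoping : ∀ n (f g : ℕ → ℚ) → (∀ k → f k ≡ g (suc k) - g k) → sumℚ n f ≡ g n - g 0
sumℚ-telescoping zero    f g _    = sym (+-inverseʳ (g 0))
sumℚ-telescoping (suc n) f g f≡Δg = begin
  sumℚ (suc n) f                                ≡⟨ sumℚ-suc n f ⟩
  f 0 + sumℚ n (λ k → f (suc k))                ≡⟨ cong₂ _+_ (f≡Δg 0) (sumℚ-telescoping n (λ k → f (suc k)) (λ k → g (suc k)) (λ k → f≡Δg (suc k))) ⟩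
  (g 1 - g 0) + (g (suc n) - g 1)               ≡⟨ collapse (g 0) (g 1) (g (suc n)) ⟩
  g (suc n) - g 0                               ∎
  where
  open ≡-Reasoning
  collapse : ∀ a b c → (b - a) + (c - b) ≡ c - a
  collapse = solve-∀ ℚ-ring

cbin-step : ∀ k → ℕ→ℚ (2 ℕ.* suc k) * cbin (suc k) ≡ ℕ→ℚ 4 * (ℕ→ℚ (suc (2 ℕ.* k)) * cbin k)
cbin-step k = begin
  ℕ→ℚ (2 ℕ.* suc k) * cbin (suc k)                       ≡⟨ ℕ→ℚ-* (2 ℕ.* suc k) ((2 ℕ.* suc k) C suc k) ⟨
  ℕ→ℚ (2 ℕ.* suc k ℕ.* ((2 ℕ.* suc k) C suc k))          ≡⟨ cong ℕ→ℚ ([2k+2]*[2k+2]C[k+1]≡4*[2k+1]*[2k]Ck k) ⟩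
  ℕ→ℚ (4 ℕ.* suc (2 ℕ.* k) ℕ.* ((2 ℕ.* k) C k))          ≡⟨ cong ℕ→ℚ (ℕ.*-assoc 4 (suc (2 ℕ.* k)) ((2 ℕ.* k) C k)) ⟩
  ℕ→ℚ (4 ℕ.* (suc (2 ℕ.* k) ℕ.* ((2 ℕ.* k) C k)))        ≡⟨ ℕ→ℚ-* 4 (suc (2 ℕ.* k) ℕ.* ((2 ℕ.* k) C k)) ⟩
  ℕ→ℚ 4 * ℕ→ℚ (suc (2 ℕ.* k) ℕ.* ((2 ℕ.* k) C k))        ≡⟨ cong (ℕ→ℚ 4 *_) (ℕ→ℚ-* (suc (2 ℕ.* k)) ((2 ℕ.* k) C k)) ⟩
  ℕ→ℚ 4 * (ℕ→ℚ (suc (2 ℕ.* k)) * cbin k)                ∎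
  where open ≡-Reasoning

4^ℚm*inv4^ℚm≡1 : ∀ m → ℕ→ℚ 4 ^ℚ m * inv 4 ^ℚ m ≡ 1ℚ
4^ℚm*inv4^ℚm≡1 m = trans (sym (^ℚ-distribʳ-* (ℕ→ℚ 4) (inv 4) m)) (1^ℚn≡1 m)

series-telescoping : ∀ m .{{_ : ℕ.NonZero m}} (κ ε : ℚ) (f : ℕ → ℚ) → ε * ε ≡ 1ℚ →
  (∀ k → f k ≡ κ * (ℕ→ℚ (suc (2 ℕ.* k)) ^ℚ m - ε * ℕ→ℚ (2 ℕ.* k) ^ℚ m)) → ∀ n →
  sumℚ n (λ k → f k * cbin k ^ℚ m * (ε * inv 4 ^ℚ m) ^ℚ k)
    ≡ κ * ε * (ℕ→ℚ (2 ℕ.* n) * cbin n) ^ℚ m * (ε * inv 4 ^ℚ m) ^ℚ n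
series-telescoping m@(suc m′) κ ε f ε²≡1 f≡ n = begin
  sumℚ n (λ k → f k * cbin k ^ℚ m * x ^ℚ k)   ≡⟨ sumℚ-telescoping n _ g Δg ⟩
  g n - g 0                                 ≡⟨ cong (λ z → g n - z) (vanish κ ε (0ℚ ^ℚ m′)) ⟩
  g n - 0ℚ                                  ≡⟨ +-identityʳ (g n) ⟩
  g n                                       ∎
  where
  open ≡-Reasoning
  x = ε * inv 4 ^ℚ m
  g : ℕ → ℚ
  g n = κ * ε * (ℕ→ℚ (2 ℕ.* n) * cbin n) ^ℚ m * x ^ℚ n
  vanish : ∀ κ ε u → κ * ε * (0ℚ * u) * 1ℚ ≡ 0ℚ
  vanish = solve-∀ ℚ-ring
  Δg : ∀ k → f k * cbin k ^ℚ m * x ^ℚ k ≡ g (suc k) - g k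
  Δg k = begin
    f k * cᵐ * x ^ℚ k
      ≡⟨ cong (λ z → z * cᵐ * x ^ℚ k) (f≡ k) ⟩
    κ * (aᵐ - ε * bᵐ) * cᵐ * x ^ℚ k
      ≡⟨ cong (λ u → κ * (u - ε * bᵐ) * cᵐ * x ^ℚ k) aᵐ≡aᵐε²4ᵐ4⁻ᵐ ⟩
    κ * (aᵐ * ((ε * ε) * (4ᵐ * 4⁻ᵐ)) - ε * bᵐ) * cᵐ * x ^ℚ k
      ≡⟨ expand κ ε aᵐ bᵐ cᵐ 4ᵐ 4⁻ᵐ (x ^ℚ k) ⟩
    κ * ε * (4ᵐ * (aᵐ * cᵐ)) * (x * x ^ℚ k) - κ * ε * (bᵐ * cᵐ) * x ^ℚ k
      ≡⟨ cong₂ (λ u v → κ * ε * u * (x * x ^ℚ k) - κ * ε * v * x ^ℚ k) [4ac]ᵐ (sym (^ℚ-distribʳ-* b c m)) ⟩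
    κ * ε * (ℕ→ℚ 4 * (a * c)) ^ℚ m * (x * x ^ℚ k) - κ * ε * (b * c) ^ℚ m * x ^ℚ k
      ≡⟨ cong (λ u → κ * ε * u ^ℚ m * (x * x ^ℚ k) - g k) (cbin-step k) ⟨
    g (suc k) - g k ∎
    where
    a = ℕ→ℚ (suc (2 ℕ.* k))
    b = ℕ→ℚ (2 ℕ.* k)
    c = cbin k
    aᵐ = a ^ℚ m
    bᵐ = b ^ℚ m
    cᵐ = c ^ℚ m
    4ᵐ = ℕ→ℚ 4 ^ℚ m
    4⁻ᵐ = inv 4 ^ℚ m
    aᵐ≡aᵐε²4ᵐ4⁻ᵐ : aᵐ ≡ aᵐ * ((ε * ε) * (4ᵐ * 4⁻ᵐ))
    aᵐ≡aᵐε²4ᵐ4⁻ᵐ = sym (trans (cong₂ (λ u v → aᵐ * (u * v)) ε²≡1 (4^ℚm*inv4^ℚm≡1 m)) (*-identityʳ aᵐ))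
    expand : ∀ κ ε A B C F y X → κ * (A * ((ε * ε) * (F * y)) - ε * B) * C * X
                                  ≡ κ * ε * (F * (A * C)) * (ε * y * X) - κ * ε * (B * C) * X
    expand = solve-∀ ℚ-ring
    [4ac]ᵐ : 4ᵐ * (aᵐ * cᵐ) ≡ (ℕ→ℚ 4 * (a * c)) ^ℚ m
    [4ac]ᵐ = sym (trans (^ℚ-distribʳ-* (ℕ→ℚ 4) (a * c) m) (cong (4ᵐ *_) (^ℚ-distribʳ-* a c m)))

d*x≡t⇒∣d∣∣∣t∣ : ∀ {d x t : ℤ} → d ℤ.* x ≡ t → ℤ.∣ d ∣ ∣ ℤ.∣ t ∣
d*x≡t⇒∣d∣∣∣t∣ {d} {x} d*x≡t =
  divides ℤ.∣ x ∣ (trans (cong ℤ.∣_∣ (sym d*x≡t)) (trans (ℤ.abs-* d x) (ℕ.*-comm ℤ.∣ d ∣ ℤ.∣ x ∣)))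

↧ₙ[x*y]∣↧ₙx*↧ₙy : ∀ x y → ↧ₙ (x * y) ∣ ↧ₙ x ℕ.* ↧ₙ y
↧ₙ[x*y]∣↧ₙx*↧ₙy x y = subst (↧ₙ (x * y) ∣_) (ℤ.abs-* (↧ x) (↧ y)) (d*x≡t⇒∣d∣∣∣t∣ {d = ↧ (x * y)} (↧-* x y))

↧ₙ[x+y]∣↧ₙx*↧ₙy : ∀ x y → ↧ₙ (x + y) ∣ ↧ₙ x ℕ.* ↧ₙ y
↧ₙ[x+y]∣↧ₙx*↧ₙy x y = subst (↧ₙ (x + y) ∣_) (ℤ.abs-* (↧ x) (↧ y)) (d*x≡t⇒∣d∣∣∣t∣ {d = ↧ (x + y)} (↧-+ x y))

module pAdic {p : ℕ} (p-prime : Prime p) where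

  -- x ∈ ℤ₍ₚ₎. This and _≡_[mod-p^_] are records rather than plain definitions
  -- so that their indices can be inferred by unification.
  record Integral (x : ℚ) : Set where
    constructor integral
    field
      p∤↧x : ¬ p ∣ ↧ₙ x

  p∤1 : ¬ p ∣ 1
  p∤1 p∣1 = nonTrivial⇒≢1 {{prime⇒nonTrivial p-prime}} (∣1⇒≡1 p∣1)

  integral-ℕ→ℚ : ∀ n → Integral (ℕ→ℚ n)
  integral-ℕ→ℚ n rewrite ℕ→ℚ≡mkℚ n = integral p∤1

  integral-* : ∀ {x y} → Integral x → Integral y → Integral (x * y)
  integral-* {x} {y} (integral p∤↧x) (integral p∤↧y) = integral λ p∣↧xy →
    [ p∤↧x , p∤↧y ] (euclidsLemma (↧ₙ x) (↧ₙ y) p-prime (∣-trans p∣↧xy (↧ₙ[x*y]∣↧ₙx*↧ₙy x y)))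

  integral-+ : ∀ {x y} → Integral x → Integral y → Integral (x + y)
  integral-+ {x} {y} (integral p∤↧x) (integral p∤↧y) = integral λ p∣↧x+y →
    [ p∤↧x , p∤↧y ] (euclidsLemma (↧ₙ x) (↧ₙ y) p-prime (∣-trans p∣↧x+y (↧ₙ[x+y]∣↧ₙx*↧ₙy x y)))

  integral-neg : ∀ {x} → Integral x → Integral (- x)
  integral-neg {x} (integral p∤↧x) = integral λ p∣↧-x → p∤↧x (subst (p ∣_) (cong ℤ.∣_∣ (↧-neg x)) p∣↧-x)

  integral-^ : ∀ {x} → Integral x → ∀ n → Integral (x ^ℚ n)
  integral-^ ∫x zero    = integral p∤1
  integral-^ ∫x (suc n) = integral-* ∫x (integral-^ ∫x n)

  p∤2 : p ≢ 2 → ¬ p ∣ 2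
  p∤2 p≢2 p∣2 with prime⇒irreducible prime[2] p∣2
  ... | inj₁ p≡1 = nonTrivial⇒≢1 {{prime⇒nonTrivial p-prime}} p≡1
  ... | inj₂ p≡2 = p≢2 p≡2

  integral-inv4 : p ≢ 2 → Integral (inv 4)
  integral-inv4 p≢2 = integral λ p∣4 → [ p∤2 p≢2 , p∤2 p≢2 ] (euclidsLemma 2 2 p-prime p∣4)

  infix 4 _≡_[mod-p^_]

  record _≡_[mod-p^_] (a b : ℚ) (k : ℕ) : Set where
    constructor divisible
    field
      quotient          : ℚ
      quotient-integral : Integral quotient
      difference        : a - b ≡ ℕ→ℚ (p ℕ.^ k) * quotient

  toCongModPow : ∀ {a b k} → a ≡ b [mod-p^ k ] → CongModPow p k a b
  toCongModPow (divisible c (integral p∤↧c) eq) = c , p∤↧c , eq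

  module _ {k : ℕ} where

    private
      pᵏ : ℚ
      pᵏ = ℕ→ℚ (p ℕ.^ k)

    ≡⇒≡[mod-p^k] : ∀ {a b} → a ≡ b → a ≡ b [mod-p^ k ]
    ≡⇒≡[mod-p^k] {a} refl = divisible 0ℚ (integral p∤1) (trans (+-inverseʳ a) (sym (*-zeroʳ pᵏ)))

    ≡[mod-p^k]-sym : ∀ {a b} → a ≡ b [mod-p^ k ] → b ≡ a [mod-p^ k ]
    ≡[mod-p^k]-sym {a} {b} (divisible c ∫c a-b≡pᵏc) = divisible (- c) (integral-neg ∫c) (begin
      b - a          ≡⟨ swap a b ⟩
      - (a - b)      ≡⟨ cong -_ a-b≡pᵏc ⟩
      - (pᵏ * c)     ≡⟨ neg-distribʳ-* pᵏ c ⟩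
      pᵏ * - c       ∎)
      where
      open ≡-Reasoning
      swap : ∀ a b → b - a ≡ - (a - b)
      swap = solve-∀ ℚ-ring

    ≡[mod-p^k]-trans : ∀ {a b d} → a ≡ b [mod-p^ k ] → b ≡ d [mod-p^ k ] → a ≡ d [mod-p^ k ]
    ≡[mod-p^k]-trans {a} {b} {d} (divisible c ∫c a-b≡pᵏc) (divisible e ∫e b-d≡pᵏe) =
      divisible (c + e) (integral-+ ∫c ∫e) (begin
        a - d                 ≡⟨ split a b d ⟩
        (a - b) + (b - d)     ≡⟨ cong₂ _+_ a-b≡pᵏc b-d≡pᵏe ⟩
        pᵏ * c + pᵏ * e       ≡⟨ *-distribˡ-+ pᵏ c e ⟨
        pᵏ * (c + e)          ∎)
      where
      open ≡-Reasoning
      split : ∀ a b d → a - d ≡ (a - b) + (b - d)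
      split = solve-∀ ℚ-ring

    ≡[mod-p^k]-respˡ : ∀ {a a′ b} → a ≡ a′ → a ≡ b [mod-p^ k ] → a′ ≡ b [mod-p^ k ]
    ≡[mod-p^k]-respˡ refl a≡b = a≡b

    ≡[mod-p^k]-respʳ : ∀ {a b b′} → b ≡ b′ → a ≡ b [mod-p^ k ] → a ≡ b′ [mod-p^ k ]
    ≡[mod-p^k]-respʳ refl a≡b = a≡b

    ≡[mod-p^k]-setoid : Setoid _ _
    ≡[mod-p^k]-setoid = record
      { Carrier       = ℚ
      ; _≈_           = _≡_[mod-p^ k ]
      ; isEquivalence = record
        { refl  = ≡⇒≡[mod-p^k] refl
        ; sym   = ≡[mod-p^k]-sym
        ; trans = ≡[mod-p^k]-trans
        }
      }

    *-congˡ-≡[mod-p^k] : ∀ x {a b} → Integral x → a ≡ b [mod-p^ k ] → x * a ≡ x * b [mod-p^ k ]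
    *-congˡ-≡[mod-p^k] x {a} {b} ∫x (divisible c ∫c a-b≡pᵏc) = divisible (x * c) (integral-* ∫x ∫c) (begin
      x * a - x * b     ≡⟨ factor x a b ⟩
      x * (a - b)       ≡⟨ cong (x *_) a-b≡pᵏc ⟩
      x * (pᵏ * c)      ≡⟨ exchange x pᵏ c ⟩
      pᵏ * (x * c)      ∎)
      where
      open ≡-Reasoning
      factor : ∀ x a b → x * a - x * b ≡ x * (a - b)
      factor = solve-∀ ℚ-ring
      exchange : ∀ x y z → x * (y * z) ≡ y * (x * z)
      exchange = solve-∀ ℚ-ring

    *-congʳ-≡[mod-p^k] : ∀ x {a b} → Integral x → a ≡ b [mod-p^ k ] → a * x ≡ b * x [mod-p^ k ]
    *-congʳ-≡[mod-p^k] x {a} {b} ∫x a≡b =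
      subst₂ _≡_[mod-p^ k ] (*-comm x a) (*-comm x b) (*-congˡ-≡[mod-p^k] x ∫x a≡b)

    ^-cong-≡[mod-p^k] : ∀ {a b} → Integral a → Integral b → a ≡ b [mod-p^ k ] → ∀ n → a ^ℚ n ≡ b ^ℚ n [mod-p^ k ]
    ^-cong-≡[mod-p^k] ∫a ∫b a≡b zero            = ≡⇒≡[mod-p^k] refl
    ^-cong-≡[mod-p^k] {a} {b} ∫a ∫b a≡b (suc n) = begin
      a * a ^ℚ n     ≈⟨ *-congˡ-≡[mod-p^k] a ∫a (^-cong-≡[mod-p^k] ∫a ∫b a≡b n) ⟩
      a * b ^ℚ n     ≈⟨ *-congʳ-≡[mod-p^k] (b ^ℚ n) (integral-^ ∫b n) a≡b ⟩
      b * b ^ℚ n     ∎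
      where open SetoidReasoning ≡[mod-p^k]-setoid

  p^j*-≡[mod-p^j+k] : ∀ {k a b} j → a ≡ b [mod-p^ k ] → ℕ→ℚ p ^ℚ j * a ≡ ℕ→ℚ p ^ℚ j * b [mod-p^ j ℕ.+ k ]
  p^j*-≡[mod-p^j+k] {k} {a} {b} j (divisible c ∫c a-b≡pᵏc) = divisible c ∫c (begin
    pʲ * a - pʲ * b                              ≡⟨ factor pʲ a b ⟩
    pʲ * (a - b)                                 ≡⟨ cong (pʲ *_) a-b≡pᵏc ⟩
    pʲ * (ℕ→ℚ (p ℕ.^ k) * c)                     ≡⟨ assoc pʲ (ℕ→ℚ (p ℕ.^ k)) c ⟩
    pʲ * ℕ→ℚ (p ℕ.^ k) * c                       ≡⟨ cong (λ x → x * ℕ→ℚ (p ℕ.^ k) * c) (ℕ→ℚ-^ p j) ⟨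
    ℕ→ℚ (p ℕ.^ j) * ℕ→ℚ (p ℕ.^ k) * c            ≡⟨ cong (_* c) (ℕ→ℚ-* (p ℕ.^ j) (p ℕ.^ k)) ⟨
    ℕ→ℚ (p ℕ.^ j ℕ.* p ℕ.^ k) * c                ≡⟨ cong (λ x → ℕ→ℚ x * c) (ℕ.^-distribˡ-+-* p j k) ⟨
    ℕ→ℚ (p ℕ.^ (j ℕ.+ k)) * c                    ∎)
    where
    open ≡-Reasoning
    pʲ = ℕ→ℚ p ^ℚ j
    factor : ∀ x a b → x * a - x * b ≡ x * (a - b)
    factor = solve-∀ ℚ-ring
    assoc : ∀ a b c → a * (b * c) ≡ a * b * c
    assoc = solve-∀ ℚ-ring

  ℕ→ℚ-≡[mod-p^k] : ∀ {a b u} k → a ≡ b ℕ.+ p ℕ.^ k ℕ.* u → ℕ→ℚ a ≡ ℕ→ℚ b [mod-p^ k ]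
  ℕ→ℚ-≡[mod-p^k] {a} {b} {u} k a≡b+pᵏu = divisible (ℕ→ℚ u) (integral-ℕ→ℚ u) (begin
    ℕ→ℚ a - ℕ→ℚ b                                   ≡⟨ cong (λ n → ℕ→ℚ n - ℕ→ℚ b) a≡b+pᵏu ⟩
    ℕ→ℚ (b ℕ.+ p ℕ.^ k ℕ.* u) - ℕ→ℚ b               ≡⟨ cong (_- ℕ→ℚ b) (ℕ→ℚ-+ b (p ℕ.^ k ℕ.* u)) ⟩
    ℕ→ℚ b + ℕ→ℚ (p ℕ.^ k ℕ.* u) - ℕ→ℚ b             ≡⟨ cancel (ℕ→ℚ b) (ℕ→ℚ (p ℕ.^ k ℕ.* u)) ⟩
    ℕ→ℚ (p ℕ.^ k ℕ.* u)                              ≡⟨ ℕ→ℚ-* (p ℕ.^ k) u ⟩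
    ℕ→ℚ (p ℕ.^ k) * ℕ→ℚ u                            ∎)
    where
    open ≡-Reasoning
    cancel : ∀ x y → x + y - x ≡ y
    cancel = solve-∀ ℚ-ring

  -- The increments of dₙ = (1 + n - n t) tⁿ are -(n+1) tⁿ (t-1)², so dₙ ≡ d₀ = 1 (mod p²) once t ≡ 1 (mod p).
  [1+n-nt]tⁿ≡1[mod-p²] : ∀ {t} → Integral t → t ≡ 1ℚ [mod-p^ 1 ] → ∀ n →
    ((1ℚ + ℕ→ℚ n) - ℕ→ℚ n * t) * t ^ℚ n ≡ 1ℚ [mod-p^ 2 ]
  [1+n-nt]tⁿ≡1[mod-p²] {t} ∫t t≡1 zero = ≡⇒≡[mod-p^k] (base t)
    where
    base : ∀ t → ((1ℚ + 0ℚ) - 0ℚ * t) * 1ℚ ≡ 1ℚ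
    base = solve-∀ ℚ-ring
  [1+n-nt]tⁿ≡1[mod-p²] {t} ∫t t≡1@(divisible c ∫c t-1≡pc) (suc n) =
    ≡[mod-p^k]-trans (divisible quotient ∫quotient increment) ([1+n-nt]tⁿ≡1[mod-p²] ∫t t≡1 n)
    where
    N = ℕ→ℚ n
    y = t ^ℚ n
    quotient = c * c * (- (1ℚ + N) * y)
    ∫quotient : Integral quotient
    ∫quotient = integral-* (integral-* ∫c ∫c) (integral-* (integral-neg (integral-+ (integral-ℕ→ℚ 1) (integral-ℕ→ℚ n))) (integral-^ ∫t n))
    p¹ = ℕ→ℚ (p ℕ.^ 1)
    p²≡p¹*p¹ : ℕ→ℚ (p ℕ.^ 2) ≡ p¹ * p¹
    p²≡p¹*p¹ = trans (cong ℕ→ℚ (ℕ.^-distribˡ-+-* p 1 1)) (ℕ→ℚ-* (p ℕ.^ 1) (p ℕ.^ 1))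
    difference-identity : ∀ N t y → ((1ℚ + (1ℚ + N)) - (1ℚ + N) * t) * (t * y) - ((1ℚ + N) - N * t) * y
                                     ≡ (t - 1ℚ) * (t - 1ℚ) * (- (1ℚ + N) * y)
    difference-identity = solve-∀ ℚ-ring
    regroup : ∀ a b c d → a * c * (a * c) * d ≡ a * a * (c * c * d)
    regroup = solve-∀ ℚ-ring
    increment : ((1ℚ + ℕ→ℚ (suc n)) - ℕ→ℚ (suc n) * t) * t ^ℚ suc n - ((1ℚ + N) - N * t) * y
                  ≡ ℕ→ℚ (p ℕ.^ 2) * quotient
    increment = begin
      ((1ℚ + ℕ→ℚ (suc n)) - ℕ→ℚ (suc n) * t) * (t * y) - ((1ℚ + N) - N * t) * y
        ≡⟨ cong (λ M → ((1ℚ + M) - M * t) * (t * y) - ((1ℚ + N) - N * t) * y) (ℕ→ℚ-+ 1 n) ⟩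
      ((1ℚ + (1ℚ + N)) - (1ℚ + N) * t) * (t * y) - ((1ℚ + N) - N * t) * y
        ≡⟨ difference-identity N t y ⟩
      (t - 1ℚ) * (t - 1ℚ) * (- (1ℚ + N) * y)
        ≡⟨ cong (λ z → z * z * (- (1ℚ + N) * y)) t-1≡pc ⟩
      p¹ * c * (p¹ * c) * (- (1ℚ + N) * y)
        ≡⟨ regroup p¹ (- (1ℚ + N) * y) c (- (1ℚ + N) * y) ⟩
      p¹ * p¹ * quotient
        ≡⟨ cong (_* quotient) p²≡p¹*p¹ ⟨
      ℕ→ℚ (p ℕ.^ 2) * quotient ∎
      where open ≡-Reasoning

module OddPrime {p : ℕ} (p-prime : Prime p) (p≢2 : p ≢ 2) where

  open pAdic p-prime

  private
    P T Cₚ A : ℚ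
    P = ℕ→ℚ p
    T = ℕ→ℚ (2 ℕ.^ (p ℕ.∸ 1))
    Cₚ = cbin p
    A = inv 4 ^ℚ p

    r = proj₁ (prime≢2⇒odd p-prime p≢2)
    p≡2r+1 : p ≡ suc (2 ℕ.* r)
    p≡2r+1 = proj₂ (prime≢2⇒odd p-prime p≢2)

  T≡1[mod-p] : T ≡ 1ℚ [mod-p^ 1 ]
  T≡1[mod-p] with fermat p-prime p≢2
  ... | q , 2ᵖ⁻¹≡1+pq =
    ℕ→ℚ-≡[mod-p^k] 1 (trans 2ᵖ⁻¹≡1+pq (cong (λ x → 1 ℕ.+ x ℕ.* q) (sym (ℕ.*-identityʳ p))))

  Cₚ≡2[mod-p²] : Cₚ ≡ ℕ→ℚ 2 [mod-p^ 2 ]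
  Cₚ≡2[mod-p²] with babbage p-prime
  ... | u , [2p]Cp≡2+ppu =
    ℕ→ℚ-≡[mod-p^k] 2 (trans [2p]Cp≡2+ppu (cong (λ x → 2 ℕ.+ p ℕ.* x ℕ.* u) (sym (ℕ.*-identityʳ p))))

  4*A*T²≡1 : ℕ→ℚ 4 * A * (T * T) ≡ 1ℚ
  4*A*T²≡1 rewrite p≡2r+1 = begin
    ℕ→ℚ 4 * (inv 4 * inv 4 ^ℚ n) * (T′ * T′)        ≡⟨ cong (λ z → ℕ→ℚ 4 * (inv 4 * inv 4 ^ℚ n) * z) T′²≡4ⁿ ⟩
    ℕ→ℚ 4 * (inv 4 * inv 4 ^ℚ n) * ℕ→ℚ 4 ^ℚ n        ≡⟨ regroup (ℕ→ℚ 4) (inv 4) (inv 4 ^ℚ n) (ℕ→ℚ 4 ^ℚ n) ⟩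
    (ℕ→ℚ 4 * inv 4) * (ℕ→ℚ 4 ^ℚ n * inv 4 ^ℚ n)      ≡⟨ cong ((ℕ→ℚ 4 * inv 4) *_) (4^ℚm*inv4^ℚm≡1 n) ⟩
    1ℚ                                              ∎
    where
    open ≡-Reasoning
    n = 2 ℕ.* r
    T′ = ℕ→ℚ (2 ℕ.^ n)
    T′²≡4ⁿ : T′ * T′ ≡ ℕ→ℚ 4 ^ℚ n
    T′²≡4ⁿ = trans (cong (λ z → z * z) (ℕ→ℚ-^ 2 n)) (sym (^ℚ-distribʳ-* (ℕ→ℚ 2) (ℕ→ℚ 2) n))
    regroup : ∀ a b c d → a * (b * c) * d ≡ (a * b) * (d * c)
    regroup = solve-∀ ℚ-ring

  ∫T : Integral T
  ∫T = integral-ℕ→ℚ (2 ℕ.^ (p ℕ.∸ 1))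

  ∫4A : Integral (ℕ→ℚ 4 * A)
  ∫4A = integral-* (integral-ℕ→ℚ 4) (integral-^ (integral-inv4 p≢2) p)

  [4A]ᵐ≡1+2m-2mT[mod-p²] : ∀ m → (ℕ→ℚ 4 * A) ^ℚ m ≡ (1ℚ + ℕ→ℚ (2 ℕ.* m)) - ℕ→ℚ (2 ℕ.* m) * T [mod-p^ 2 ]
  [4A]ᵐ≡1+2m-2mT[mod-p²] m = begin
    X                          ≡⟨ *-identityʳ X ⟨
    X * 1ℚ                     ≈⟨ *-congˡ-≡[mod-p^k] X (integral-^ ∫4A m) ([1+n-nt]tⁿ≡1[mod-p²] ∫T T≡1[mod-p] (2 ℕ.* m)) ⟨
    X * (s * T ^ℚ (2 ℕ.* m))   ≡⟨ cong (λ z → X * (s * z)) (x²^ℚn≡x^ℚ2n T m) ⟨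
    X * (s * (T * T) ^ℚ m)     ≡⟨ exchange X s ((T * T) ^ℚ m) ⟩
    s * (X * (T * T) ^ℚ m)     ≡⟨ cong (s *_) (^ℚ-distribʳ-* (ℕ→ℚ 4 * A) (T * T) m) ⟨
    s * (ℕ→ℚ 4 * A * (T * T)) ^ℚ m ≡⟨ cong (λ z → s * z ^ℚ m) 4*A*T²≡1 ⟩
    s * 1ℚ ^ℚ m                ≡⟨ cong (s *_) (1^ℚn≡1 m) ⟩
    s * 1ℚ                     ≡⟨ *-identityʳ s ⟩
    s                          ∎
    where
    open SetoidReasoning ≡[mod-p^k]-setoid
    X = (ℕ→ℚ 4 * A) ^ℚ m
    s = (1ℚ + ℕ→ℚ (2 ℕ.* m)) - ℕ→ℚ (2 ℕ.* m) * T
    exchange : ∀ x y z → x * (y * z) ≡ y * (x * z)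
    exchange = solve-∀ ℚ-ring

  κ[2pCₚ]ᵐAᵐ≡κ[1+2m-2mT]pᵐ : ∀ m κ →
    ℕ→ℚ κ * (ℕ→ℚ (2 ℕ.* p) * Cₚ) ^ℚ m * A ^ℚ m ≡ ℕ→ℚ κ * ((1ℚ + ℕ→ℚ (2 ℕ.* m)) - ℕ→ℚ (2 ℕ.* m) * T) * P ^ℚ m [mod-p^ m ℕ.+ 2 ]
  κ[2pCₚ]ᵐAᵐ≡κ[1+2m-2mT]pᵐ m κ = begin
    K * (ℕ→ℚ (2 ℕ.* p) * Cₚ) ^ℚ m * A ^ℚ m       ≡⟨ cong (λ z → K * z ^ℚ m * A ^ℚ m) (trans (cong (_* Cₚ) (ℕ→ℚ-* 2 p)) (swap (ℕ→ℚ 2) P Cₚ)) ⟩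
    K * (P * (ℕ→ℚ 2 * Cₚ)) ^ℚ m * A ^ℚ m         ≡⟨ cong (λ z → K * z * A ^ℚ m) (^ℚ-distribʳ-* P (ℕ→ℚ 2 * Cₚ) m) ⟩
    K * (P ^ℚ m * (ℕ→ℚ 2 * Cₚ) ^ℚ m) * A ^ℚ m    ≡⟨ regroup K (P ^ℚ m) ((ℕ→ℚ 2 * Cₚ) ^ℚ m) (A ^ℚ m) ⟩
    P ^ℚ m * (K * ((ℕ→ℚ 2 * Cₚ) ^ℚ m * A ^ℚ m))  ≈⟨ p^j*-≡[mod-p^j+k] m (*-congˡ-≡[mod-p^k] K ∫K (*-congʳ-≡[mod-p^k] (A ^ℚ m) ∫Aᵐ 2ᵐCᵐ≡4ᵐ)) ⟩
    P ^ℚ m * (K * (ℕ→ℚ 4 ^ℚ m * A ^ℚ m))        ≡⟨ cong (λ z → P ^ℚ m * (K * z)) (^ℚ-distribʳ-* (ℕ→ℚ 4) A m) ⟨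
    P ^ℚ m * (K * (ℕ→ℚ 4 * A) ^ℚ m)             ≈⟨ p^j*-≡[mod-p^j+k] m (*-congˡ-≡[mod-p^k] K ∫K ([4A]ᵐ≡1+2m-2mT[mod-p²] m)) ⟩
    P ^ℚ m * (K * s)                            ≡⟨ rotate (P ^ℚ m) K s ⟩
    K * s * P ^ℚ m                              ∎
    where
    open SetoidReasoning ≡[mod-p^k]-setoid
    K = ℕ→ℚ κ
    s = (1ℚ + ℕ→ℚ (2 ℕ.* m)) - ℕ→ℚ (2 ℕ.* m) * T
    ∫K : Integral K
    ∫K = integral-ℕ→ℚ κ
    ∫Aᵐ : Integral (A ^ℚ m)
    ∫Aᵐ = integral-^ (integral-^ (integral-inv4 p≢2) p) m
    2ᵐCᵐ≡4ᵐ : (ℕ→ℚ 2 * Cₚ) ^ℚ m ≡ ℕ→ℚ 4 ^ℚ m [mod-p^ 2 ]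
    2ᵐCᵐ≡4ᵐ = ^-cong-≡[mod-p^k] (integral-* (integral-ℕ→ℚ 2) (integral-ℕ→ℚ ((2 ℕ.* p) C p))) (integral-ℕ→ℚ 4)
                 (*-congˡ-≡[mod-p^k] (ℕ→ℚ 2) (integral-ℕ→ℚ 2) Cₚ≡2[mod-p²]) m
    swap : ∀ a b c → a * b * c ≡ b * (a * c)
    swap = solve-∀ ℚ-ring
    regroup : ∀ k a b c → k * (a * b) * c ≡ a * (k * (b * c))
    regroup = solve-∀ ℚ-ring
    rotate : ∀ a k s → a * (k * s) ≡ k * s * a
    rotate = solve-∀ ℚ-ring

  [ε*inv4ᵐ]ᵖ≡ε*Aᵐ : ∀ ε → ε * ε ≡ 1ℚ → ∀ m → (ε * inv 4 ^ℚ m) ^ℚ p ≡ ε * A ^ℚ m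
  [ε*inv4ᵐ]ᵖ≡ε*Aᵐ ε ε²≡1 m = begin
    (ε * inv 4 ^ℚ m) ^ℚ p          ≡⟨ ^ℚ-distribʳ-* ε (inv 4 ^ℚ m) p ⟩
    ε ^ℚ p * (inv 4 ^ℚ m) ^ℚ p     ≡⟨ cong₂ _*_ εᵖ≡ε (^ℚ-comm (inv 4) m p) ⟩
    ε * A ^ℚ m                     ∎
    where
    open ≡-Reasoning
    εᵖ≡ε : ε ^ℚ p ≡ ε
    εᵖ≡ε = subst (λ n → ε ^ℚ n ≡ ε) (sym p≡2r+1) (involution-^ℚ-odd ε²≡1 r)

  series-congruence : ∀ m .{{_ : ℕ.NonZero m}} κ ε (f : ℕ → ℕ) → ε * ε ≡ 1ℚ →
    (∀ k → ℕ→ℚ (f k) ≡ ℕ→ℚ κ * (ℕ→ℚ (suc (2 ℕ.* k) ℕ.^ m) - ε * ℕ→ℚ ((2 ℕ.* k) ℕ.^ m))) →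
    sumℚ p (λ k → ℕ→ℚ (f k) * cbin k ^ℚ m * (ε * inv 4 ^ℚ m) ^ℚ k)
      ≡ ℕ→ℚ κ * ((1ℚ + ℕ→ℚ (2 ℕ.* m)) - ℕ→ℚ (2 ℕ.* m) * T) * P ^ℚ m [mod-p^ m ℕ.+ 2 ]
  series-congruence m κ ε f ε²≡1 f≡ = begin
    sumℚ p (λ k → ℕ→ℚ (f k) * cbin k ^ℚ m * x ^ℚ k)
      ≡⟨ series-telescoping m K ε (λ k → ℕ→ℚ (f k)) ε²≡1 f≡′ p ⟩
    K * ε * (ℕ→ℚ (2 ℕ.* p) * Cₚ) ^ℚ m * x ^ℚ p
      ≡⟨ cong (K * ε * (ℕ→ℚ (2 ℕ.* p) * Cₚ) ^ℚ m *_) ([ε*inv4ᵐ]ᵖ≡ε*Aᵐ ε ε²≡1 m) ⟩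
    K * ε * Z * (ε * A ^ℚ m)
      ≡⟨ regroup K ε Z (A ^ℚ m) ⟩
    K * (ε * ε) * Z * A ^ℚ m
      ≡⟨ cong (λ e → K * e * Z * A ^ℚ m) ε²≡1 ⟩
    K * 1ℚ * Z * A ^ℚ m
      ≡⟨ cong (λ k → k * Z * A ^ℚ m) (*-identityʳ K) ⟩
    K * Z * A ^ℚ m
      ≈⟨ κ[2pCₚ]ᵐAᵐ≡κ[1+2m-2mT]pᵐ m κ ⟩
    K * ((1ℚ + ℕ→ℚ (2 ℕ.* m)) - ℕ→ℚ (2 ℕ.* m) * T) * P ^ℚ m ∎
    where
    open SetoidReasoning ≡[mod-p^k]-setoid
    K = ℕ→ℚ κ
    x = ε * inv 4 ^ℚ m
    Z = (ℕ→ℚ (2 ℕ.* p) * Cₚ) ^ℚ m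
    f≡′ : ∀ k → ℕ→ℚ (f k) ≡ K * (ℕ→ℚ (suc (2 ℕ.* k)) ^ℚ m - ε * ℕ→ℚ (2 ℕ.* k) ^ℚ m)
    f≡′ k = trans (f≡ k) (cong₂ (λ a b → K * (a - ε * b)) (ℕ→ℚ-^ (suc (2 ℕ.* k)) m) (ℕ→ℚ-^ (2 ℕ.* k) m))
    regroup : ∀ k e z a → k * e * z * (e * a) ≡ k * (e * e) * z * a
    regroup = solve-∀ ℚ-ring

  series-congruence⁻ : ∀ m .{{_ : ℕ.NonZero m}} κ {f : ℕ → ℕ} → (∀ k → f k ≡ κ ℕ.* (suc (2 ℕ.* k) ℕ.^ m ℕ.+ (2 ℕ.* k) ℕ.^ m)) →
    sumℚ p (λ k → ℕ→ℚ (f k) * cbin k ^ℚ m * ((- 1ℚ) * inv 4 ^ℚ m) ^ℚ k)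
      ≡ ℕ→ℚ κ * ((1ℚ + ℕ→ℚ (2 ℕ.* m)) - ℕ→ℚ (2 ℕ.* m) * T) * P ^ℚ m [mod-p^ m ℕ.+ 2 ]
  series-congruence⁻ m κ {f} f≡ = series-congruence m κ (- 1ℚ) f refl (λ k → ℕ→ℚ-κ[a+b] κ (suc (2 ℕ.* k) ℕ.^ m) ((2 ℕ.* k) ℕ.^ m) (f≡ k))

  series-congruence⁺ : ∀ m .{{_ : ℕ.NonZero m}} κ {f : ℕ → ℕ} → (∀ k → κ ℕ.* (2 ℕ.* k) ℕ.^ m ℕ.+ f k ≡ κ ℕ.* suc (2 ℕ.* k) ℕ.^ m) →
    sumℚ p (λ k → ℕ→ℚ (f k) * cbin k ^ℚ m * (1ℚ * inv 4 ^ℚ m) ^ℚ k)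
      ≡ ℕ→ℚ κ * ((1ℚ + ℕ→ℚ (2 ℕ.* m)) - ℕ→ℚ (2 ℕ.* m) * T) * P ^ℚ m [mod-p^ m ℕ.+ 2 ]
  series-congruence⁺ m κ {f} f≡ = series-congruence m κ 1ℚ f refl (λ k → ℕ→ℚ-κ[a-b] κ (suc (2 ℕ.* k) ℕ.^ m) ((2 ℕ.* k) ℕ.^ m) (f≡ k))

  2^[p+j]≡2^[j+1]*T : ∀ j → ℕ→ℚ (2 ℕ.^ (p ℕ.+ j)) ≡ ℕ→ℚ (2 ℕ.^ suc j) * T
  2^[p+j]≡2^[j+1]*T j = trans (cong ℕ→ℚ (2^[p+j]≡2^[j+1]*2^[p∸1] p-prime j)) (ℕ→ℚ-* (2 ℕ.^ suc j) (2 ℕ.^ (p ℕ.∸ 1)))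

  1*[3-2T]p¹≡[3-2ᵖ]p :
    ℕ→ℚ 1 * ((1ℚ + ℕ→ℚ 2) - ℕ→ℚ 2 * T) * P ^ℚ 1 ≡ (ℕ→ℚ 3 - ℕ→ℚ (2 ℕ.^ p)) * P
  1*[3-2T]p¹≡[3-2ᵖ]p = begin
    ℕ→ℚ 1 * ((1ℚ + ℕ→ℚ 2) - ℕ→ℚ 2 * T) * (P * 1ℚ)   ≡⟨ simplify T P ⟩
    (ℕ→ℚ 3 - ℕ→ℚ 2 * T) * P                         ≡⟨ cong (λ x → (ℕ→ℚ 3 - x) * P) (2^[p+j]≡2^[j+1]*T 0) ⟨
    (ℕ→ℚ 3 - ℕ→ℚ (2 ℕ.^ (p ℕ.+ 0))) * P             ≡⟨ cong (λ n → (ℕ→ℚ 3 - ℕ→ℚ (2 ℕ.^ n)) * P) (ℕ.+-identityʳ p) ⟩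
    (ℕ→ℚ 3 - ℕ→ℚ (2 ℕ.^ p)) * P                     ∎
    where
    open ≡-Reasoning
    simplify : ∀ T P → ℕ→ℚ 1 * ((1ℚ + ℕ→ℚ 2) - ℕ→ℚ 2 * T) * (P * 1ℚ) ≡ (ℕ→ℚ 3 - ℕ→ℚ 2 * T) * P
    simplify = solve-∀ ℚ-ring

  1*[5-4T]p²≡[5-2ᵖ⁺¹]p² :
    ℕ→ℚ 1 * ((1ℚ + ℕ→ℚ 4) - ℕ→ℚ 4 * T) * P ^ℚ 2 ≡ (ℕ→ℚ 5 - ℕ→ℚ (2 ℕ.^ (p ℕ.+ 1))) * P ^ℚ 2
  1*[5-4T]p²≡[5-2ᵖ⁺¹]p² = trans (simplify T (P ^ℚ 2)) (cong (λ x → (ℕ→ℚ 5 - x) * P ^ℚ 2) (sym (2^[p+j]≡2^[j+1]*T 1)))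
    where
    simplify : ∀ T X → ℕ→ℚ 1 * ((1ℚ + ℕ→ℚ 4) - ℕ→ℚ 4 * T) * X ≡ (ℕ→ℚ 5 - ℕ→ℚ 4 * T) * X
    simplify = solve-∀ ℚ-ring

  8[9-8T]p⁴≡8[9-2ᵖ⁺²]p⁴ :
    ℕ→ℚ 8 * ((1ℚ + ℕ→ℚ 8) - ℕ→ℚ 8 * T) * P ^ℚ 4 ≡ ℕ→ℚ 8 * (ℕ→ℚ 9 - ℕ→ℚ (2 ℕ.^ (p ℕ.+ 2))) * P ^ℚ 4
  8[9-8T]p⁴≡8[9-2ᵖ⁺²]p⁴ = cong (λ x → ℕ→ℚ 8 * (ℕ→ℚ 9 - x) * P ^ℚ 4) (sym (2^[p+j]≡2^[j+1]*T 2))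

  4*2[9-8T]p⁴≡8[9-2ᵖ⁺²]p⁴ :
    ℕ→ℚ 4 * (ℕ→ℚ 2 * ((1ℚ + ℕ→ℚ 8) - ℕ→ℚ 8 * T) * P ^ℚ 4) ≡ ℕ→ℚ 8 * (ℕ→ℚ 9 - ℕ→ℚ (2 ℕ.^ (p ℕ.+ 2))) * P ^ℚ 4
  4*2[9-8T]p⁴≡8[9-2ᵖ⁺²]p⁴ = trans (regroup ((1ℚ + ℕ→ℚ 8) - ℕ→ℚ 8 * T) (P ^ℚ 4)) 8[9-8T]p⁴≡8[9-2ᵖ⁺²]p⁴
    where
    regroup : ∀ s X → ℕ→ℚ 4 * (ℕ→ℚ 2 * s * X) ≡ ℕ→ℚ 8 * s * X
    regroup = solve-∀ ℚ-ring

module _ where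

  open +-*-Solver using (solve; con; _:+_; _:*_; _:^_; _:=_)

  4k+1≡[2k+1]+2k : ∀ k → 4 ℕ.* k ℕ.+ 1 ≡ 1 ℕ.* (suc (2 ℕ.* k) ℕ.^ 1 ℕ.+ (2 ℕ.* k) ℕ.^ 1)
  4k+1≡[2k+1]+2k = solve 1 (λ k → con 4 :* k :+ con 1 := con 1 :* ((con 1 :+ con 2 :* k) :^ 1 :+ (con 2 :* k) :^ 1)) refl

  [2k]²+[4k+1]≡[2k+1]² : ∀ k → 1 ℕ.* (2 ℕ.* k) ℕ.^ 2 ℕ.+ (4 ℕ.* k ℕ.+ 1) ≡ 1 ℕ.* suc (2 ℕ.* k) ℕ.^ 2
  [2k]²+[4k+1]≡[2k+1]² = solve 1 (λ k → con 1 :* (con 2 :* k) :^ 2 :+ (con 4 :* k :+ con 1) := con 1 :* (con 1 :+ con 2 :* k) :^ 2) refl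

  8k²+4k+1≡[2k+1]²+[2k]² : ∀ k → 8 ℕ.* k ℕ.* k ℕ.+ 4 ℕ.* k ℕ.+ 1 ≡ 1 ℕ.* (suc (2 ℕ.* k) ℕ.^ 2 ℕ.+ (2 ℕ.* k) ℕ.^ 2)
  8k²+4k+1≡[2k+1]²+[2k]² = solve 1 (λ k → con 8 :* k :* k :+ con 4 :* k :+ con 1 := con 1 :* ((con 1 :+ con 2 :* k) :^ 2 :+ (con 2 :* k) :^ 2)) refl

  3[4k+1]+[4k+1]³≡4[[2k+1]³+[2k]³] : ∀ k → 3 ℕ.* (4 ℕ.* k ℕ.+ 1) ℕ.+ (4 ℕ.* k ℕ.+ 1) ℕ.^ 3 ≡ 4 ℕ.* (suc (2 ℕ.* k) ℕ.^ 3 ℕ.+ (2 ℕ.* k) ℕ.^ 3)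
  3[4k+1]+[4k+1]³≡4[[2k+1]³+[2k]³] = solve 1 (λ k → con 3 :* (con 4 :* k :+ con 1) :+ (con 4 :* k :+ con 1) :^ 3 := con 4 :* ((con 1 :+ con 2 :* k) :^ 3 :+ (con 2 :* k) :^ 3)) refl

  4[2k]³+[1+3[4k+1]²]≡4[2k+1]³ : ∀ k → 4 ℕ.* (2 ℕ.* k) ℕ.^ 3 ℕ.+ (1 ℕ.+ 3 ℕ.* (4 ℕ.* k ℕ.+ 1) ℕ.^ 2) ≡ 4 ℕ.* suc (2 ℕ.* k) ℕ.^ 3
  4[2k]³+[1+3[4k+1]²]≡4[2k+1]³ = solve 1 (λ k → con 4 :* (con 2 :* k) :^ 3 :+ (con 1 :+ con 3 :* (con 4 :* k :+ con 1) :^ 2) := con 4 :* (con 1 :+ con 2 :* k) :^ 3) refl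

  2[2k]⁴+[[4k+1]+[4k+1]³]≡2[2k+1]⁴ : ∀ k → 2 ℕ.* (2 ℕ.* k) ℕ.^ 4 ℕ.+ ((4 ℕ.* k ℕ.+ 1) ℕ.+ (4 ℕ.* k ℕ.+ 1) ℕ.^ 3) ≡ 2 ℕ.* suc (2 ℕ.* k) ℕ.^ 4
  2[2k]⁴+[[4k+1]+[4k+1]³]≡2[2k+1]⁴ = solve 1 (λ k → con 2 :* (con 2 :* k) :^ 4 :+ ((con 4 :* k :+ con 1) :+ (con 4 :* k :+ con 1) :^ 3) := con 2 :* (con 1 :+ con 2 :* k) :^ 4) refl

  1+6[4k+1]²+[4k+1]⁴≡8[[2k+1]⁴+[2k]⁴] : ∀ k → 1 ℕ.+ 6 ℕ.* (4 ℕ.* k ℕ.+ 1) ℕ.^ 2 ℕ.+ (4 ℕ.* k ℕ.+ 1) ℕ.^ 4 ≡ 8 ℕ.* (suc (2 ℕ.* k) ℕ.^ 4 ℕ.+ (2 ℕ.* k) ℕ.^ 4)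
  1+6[4k+1]²+[4k+1]⁴≡8[[2k+1]⁴+[2k]⁴] = solve 1 (λ k → con 1 :+ con 6 :* (con 4 :* k :+ con 1) :^ 2 :+ (con 4 :* k :+ con 1) :^ 4 := con 8 :* ((con 1 :+ con 2 :* k) :^ 4 :+ (con 2 :* k) :^ 4)) refl

corollary2p1 : (p : ℕ) → Prime p → ¬ (p ≡ 2) →
    CongModPow p 3
      (sumℚ p (λ k → ℕ→ℚ (4 ℕ.* k ℕ.+ 1) * cbin k * (ninv 4 ^ℚ k)))
      ((ℕ→ℚ 3 - ℕ→ℚ (2 ℕ.^ p)) * ℕ→ℚ p)
    × CongModPow p 4
      (sumℚ p (λ k → ℕ→ℚ (4 ℕ.* k ℕ.+ 1) * (cbin k ^ℚ 2) * (inv 16 ^ℚ k)))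
      ((ℕ→ℚ 5 - ℕ→ℚ (2 ℕ.^ (p ℕ.+ 1))) * (ℕ→ℚ p ^ℚ 2))
    × CongModPow p 4
      (sumℚ p (λ k → ℕ→ℚ (8 ℕ.* k ℕ.* k ℕ.+ 4 ℕ.* k ℕ.+ 1) * (cbin k ^ℚ 2) * (ninv 16 ^ℚ k)))
      ((ℕ→ℚ 5 - ℕ→ℚ (2 ℕ.^ (p ℕ.+ 1))) * (ℕ→ℚ p ^ℚ 2))
    × CongModPow p 5
      (sumℚ p (λ k → ℕ→ℚ (3 ℕ.* (4 ℕ.* k ℕ.+ 1) ℕ.+ (4 ℕ.* k ℕ.+ 1) ℕ.^ 3) * (cbin k ^ℚ 3) * (ninv 64 ^ℚ k)))
      (ℕ→ℚ 4 * (ℕ→ℚ 7 - ℕ→ℚ 6 * ℕ→ℚ (2 ℕ.^ (p ℕ.∸ 1))) * (ℕ→ℚ p ^ℚ 3))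
    × CongModPow p 5
      (sumℚ p (λ k → ℕ→ℚ (1 ℕ.+ 3 ℕ.* (4 ℕ.* k ℕ.+ 1) ℕ.^ 2) * (cbin k ^ℚ 3) * (inv 64 ^ℚ k)))
      (ℕ→ℚ 4 * (ℕ→ℚ 7 - ℕ→ℚ 6 * ℕ→ℚ (2 ℕ.^ (p ℕ.∸ 1))) * (ℕ→ℚ p ^ℚ 3))
    × CongModPow p 6
      (ℕ→ℚ 4 * sumℚ p (λ k → ℕ→ℚ ((4 ℕ.* k ℕ.+ 1) ℕ.+ (4 ℕ.* k ℕ.+ 1) ℕ.^ 3) * (cbin k ^ℚ 4) * (inv 256 ^ℚ k)))
      (ℕ→ℚ 8 * (ℕ→ℚ 9 - ℕ→ℚ (2 ℕ.^ (p ℕ.+ 2))) * (ℕ→ℚ p ^ℚ 4))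
    × CongModPow p 6
      (sumℚ p (λ k → ℕ→ℚ (1 ℕ.+ 6 ℕ.* (4 ℕ.* k ℕ.+ 1) ℕ.^ 2 ℕ.+ (4 ℕ.* k ℕ.+ 1) ℕ.^ 4) * (cbin k ^ℚ 4) * (ninv 256 ^ℚ k)))
      (ℕ→ℚ 8 * (ℕ→ℚ 9 - ℕ→ℚ (2 ℕ.^ (p ℕ.+ 2))) * (ℕ→ℚ p ^ℚ 4))
corollary2p1 p p-prime p≢2 =
    toCongModPow (≡[mod-p^k]-respˡ (sumℚ-cong p λ k → cong (λ c → ℕ→ℚ (4 ℕ.* k ℕ.+ 1) * c * ninv 4 ^ℚ k) (*-identityʳ (cbin k)))
                  (≡[mod-p^k]-respʳ (1*[3-2T]p¹≡[3-2ᵖ]p) (series-congruence⁻ 1 1 4k+1≡[2k+1]+2k)))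
  , toCongModPow (≡[mod-p^k]-respʳ (1*[5-4T]p²≡[5-2ᵖ⁺¹]p²) (series-congruence⁺ 2 1 [2k]²+[4k+1]≡[2k+1]²))
  , toCongModPow (≡[mod-p^k]-respʳ (1*[5-4T]p²≡[5-2ᵖ⁺¹]p²) (series-congruence⁻ 2 1 8k²+4k+1≡[2k+1]²+[2k]²))
  , toCongModPow (series-congruence⁻ 3 4 3[4k+1]+[4k+1]³≡4[[2k+1]³+[2k]³])
  , toCongModPow (series-congruence⁺ 3 4 4[2k]³+[1+3[4k+1]²]≡4[2k+1]³)
  , toCongModPow (≡[mod-p^k]-respʳ (4*2[9-8T]p⁴≡8[9-2ᵖ⁺²]p⁴)
                   (*-congˡ-≡[mod-p^k] (ℕ→ℚ 4) (integral-ℕ→ℚ 4) (series-congruence⁺ 4 2 2[2k]⁴+[[4k+1]+[4k+1]³]≡2[2k+1]⁴)))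
  , toCongModPow (≡[mod-p^k]-respʳ (8[9-8T]p⁴≡8[9-2ᵖ⁺²]p⁴) (series-congruence⁻ 4 8 1+6[4k+1]²+[4k+1]⁴≡8[[2k+1]⁴+[2k]⁴]))
  where
  open pAdic p-prime
  open OddPrime p-prime p≢2
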